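{- Let $A$ be a $2\times 2$ doubly nonnegative matrix with nonnegative integer entries. Then $A=BB^T$ for some $2\times 10$ matrix $B$ with nonnegative integer entries; i.e., the integer CP rank of $A$ is at most $10$.
   Context: A matrix is doubly nonnegative if it is symmetric positive semidefinite and entrywise nonnegative. The integer CP rank of $A$ is the smallest number of columns of a nonnegative integer matrix $B$ with $A=BB^T$. -}

module Defs where

open import Data.Nat using (ℕ)
open import Data.Fin using (Fin)
open import Data.Rational using (ℚ; _+_; _*_; _≤_; 0ℚ)
open import Data.Rational using () renaming (_/_ to _/ℚ_)
import Data.Nat
import Data.Fin
open import Data.Integer using (+_)
open import Relation.Binary.PropositionalEquality using (_≡_)
open import Data.Product using (_×_)

Mat : ℕ → ℕ → Set
Mat m n = Fin m → Fin n → ℕ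

∑ : (n : ℕ) → (Fin n → ℕ) → ℕ
∑ ℕ.zero f = 0
∑ (ℕ.suc n) f = f Fin.zero Data.Nat.+ ∑ n (λ i → f (Fin.suc i))

∑ℚ : (n : ℕ) → (Fin n → ℚ) → ℚ
∑ℚ ℕ.zero f = 0ℚ
∑ℚ (ℕ.suc n) f = f Fin.zero + ∑ℚ n (λ i → f (Fin.suc i))

_·ᵀ : ∀ {m k} → Mat m k → Mat m m
(B ·ᵀ) i j = ∑ _ (λ l → B i l Data.Nat.* B j l)

toℚ : ℕ → ℚ
toℚ n = (+ n) /ℚ 1

Symmetric : ∀ {n} → Mat n n → Set
Symmetric A = ∀ i j → A i j ≡ A j i

PSD : ∀ {n} → Mat n n → Set
PSD {n} A = (x : Fin n → ℚ) →
  0ℚ ≤ ∑ℚ n (λ i → ∑ℚ n (λ j → x i * (toℚ (A i j) * x j)))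

-- doubly nonnegative (entrywise nonnegativity is automatic for ℕ entries)
DoublyNonnegative : ∀ {n} → Mat n n → Set
DoublyNonnegative A = Symmetric A × PSD A

-- For A = [[a, b], [b, c]], positive semidefiniteness gives b² ≤ ac. If a < b, the change of basis
-- (x, y) ↦ (x, x + y) reduces A to [[a, b − a], [b − a, c − 2b + a]], again nonnegative with the same
-- determinant and a smaller trace; symmetrically if c < b. So we may assume b ≤ min(a, c).
-- Then b = p₁q₁ + p₂q₂ with 0 ≤ qᵢ ≤ pᵢ and p₁² + p₂² ≤ 2b (when 2b > a, do this for a − b and
-- replace q by p − q), and four squares extend p to |p|² = a. As |q|² ≤ p·q = b ≤ c, four more squares
-- r give |q|² + |r|² = c, and x = (p, 0), y = (q, r) have 2 + 4 + 4 = 10 coordinates.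
-- Lagrange's four-square theorem is proved by Euler's identity and descent.
module Submission where

open import Defs
open import Data.Product using (Σ; _,_)
open import Relation.Binary.PropositionalEquality using (_≡_; refl; trans; cong; cong₂; subst₂)

module Quaternions where

  open import Data.Integer.Base using (ℤ; +_; _+_; _*_; _-_; NonZero)
  import Data.Integer.Properties as ℤ
  open import Data.Integer.Tactic.RingSolver using (solve-∀)
  open import Data.Product.Base using (Σ; _,_)
  open import Relation.Binary.PropositionalEquality
  open ≡-Reasoning

  record ℤ⁴ : Set where
    constructor ⟪_,_,_,_⟫
    field x₁ x₂ x₃ x₄ : ℤ

  norm : ℤ⁴ → ℤ
  norm ⟪ a , b , c , d ⟫ = a * a + b * b + c * c + d * d

  FourSquares : ℤ → Set
  FourSquares n = Σ ℤ⁴ (λ v → norm v ≡ n)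

  infixl 7 _⊛_
  infixl 6 _⊕_

  _⊛_ : ℤ → ℤ⁴ → ℤ⁴
  m ⊛ ⟪ a , b , c , d ⟫ = ⟪ m * a , m * b , m * c , m * d ⟫

  _⊕_ : ℤ⁴ → ℤ⁴ → ℤ⁴
  ⟪ a , b , c , d ⟫ ⊕ ⟪ e , f , g , h ⟫ = ⟪ a + e , b + f , c + g , d + h ⟫

  -- The quaternion product ū v, with ū the conjugate of u.
  _⋄_ : ℤ⁴ → ℤ⁴ → ℤ⁴
  ⟪ a , b , c , d ⟫ ⋄ ⟪ e , f , g , h ⟫ =
    ⟪ a * e + b * f + c * g + d * h , a * f - b * e + c * h - d * g
    , a * g - c * e + d * f - b * h , a * h - d * e + b * g - c * f ⟫

  _·_ : ℤ⁴ → ℤ⁴ → ℤ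
  u · v = ℤ⁴.x₁ (u ⋄ v)

  -- The ring solver does not unfold norm, so identities involving it are stated with the norm
  -- written out as a local function N.
  norm-⋄ : ∀ u v → norm (u ⋄ v) ≡ norm u * norm v
  norm-⋄ ⟪ a , b , c , d ⟫ ⟪ e , f , g , h ⟫ = euler a b c d e f g h
    where
    euler : ∀ a b c d e f g h →
      let N = λ (x y z w : ℤ) → x * x + y * y + z * z + w * w in
      N (a * e + b * f + c * g + d * h) (a * f - b * e + c * h - d * g)
        (a * g - c * e + d * f - b * h) (a * h - d * e + b * g - c * f)
      ≡ N a b c d * N e f g h
    euler = solve-∀

  norm-⊛ : ∀ m v → norm (m ⊛ v) ≡ m * m * norm v
  norm-⊛ m ⟪ a , b , c , d ⟫ = identity m a b c d
    where
    identity : ∀ m a b c d →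
      let N = λ (x y z w : ℤ) → x * x + y * y + z * z + w * w in
      N (m * a) (m * b) (m * c) (m * d) ≡ m * m * N a b c d
    identity = solve-∀

  norm-⊛⊕ : ∀ m k y → norm (m ⊛ k ⊕ y) ≡ m * (m * norm k + + 2 * (k · y)) + norm y
  norm-⊛⊕ m ⟪ a , b , c , d ⟫ ⟪ e , f , g , h ⟫ = identity m a b c d e f g h
    where
    identity : ∀ m a b c d e f g h →
      let N = λ (x y z w : ℤ) → x * x + y * y + z * z + w * w in
      N (m * a + e) (m * b + f) (m * c + g) (m * d + h)
      ≡ m * (m * N a b c d + + 2 * (a * e + b * f + c * g + d * h)) + N e f g h
    identity = solve-∀

  ⟪⟫-cong : ∀ {a b c d a′ b′ c′ d′} → a ≡ a′ → b ≡ b′ → c ≡ c′ → d ≡ d′ →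
            ⟪ a , b , c , d ⟫ ≡ ⟪ a′ , b′ , c′ , d′ ⟫
  ⟪⟫-cong refl refl refl refl = refl

  -- The products of components of y cancel except in the first component, where they add up to norm y.
  ⊛⊕-⋄ : ∀ m k y {t} → norm y ≡ m * t → (m ⊛ k ⊕ y) ⋄ y ≡ m ⊛ (k ⋄ y ⊕ ⟪ t , + 0 , + 0 , + 0 ⟫)
  ⊛⊕-⋄ m ⟪ a , b , c , d ⟫ ⟪ e , f , g , h ⟫ {t} y≡mt =
    ⟪⟫-cong first (second m a b c d e f g h) (third m a b c d e f g h) (fourth m a b c d e f g h)
    where
    first : (m * a + e) * e + (m * b + f) * f + (m * c + g) * g + (m * d + h) * h
          ≡ m * (a * e + b * f + c * g + d * h + t)
    first = begin
      (m * a + e) * e + (m * b + f) * f + (m * c + g) * g + (m * d + h) * h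
        ≡⟨ identity m a b c d e f g h ⟩
      m * (a * e + b * f + c * g + d * h) + norm ⟪ e , f , g , h ⟫
        ≡⟨ cong (λ z → m * (a * e + b * f + c * g + d * h) + z) y≡mt ⟩
      m * (a * e + b * f + c * g + d * h) + m * t
        ≡⟨ ℤ.*-distribˡ-+ m _ t ⟨
      m * (a * e + b * f + c * g + d * h + t) ∎
      where
      identity : ∀ m a b c d e f g h →
        (m * a + e) * e + (m * b + f) * f + (m * c + g) * g + (m * d + h) * h
        ≡ m * (a * e + b * f + c * g + d * h) + (e * e + f * f + g * g + h * h)
      identity = solve-∀
    second : ∀ m a b c d e f g h →
      (m * a + e) * f - (m * b + f) * e + (m * c + g) * h - (m * d + h) * g
      ≡ m * (a * f - b * e + c * h - d * g + + 0)
    second = solve-∀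
    third : ∀ m a b c d e f g h →
      (m * a + e) * g - (m * c + g) * e + (m * d + h) * f - (m * b + f) * h
      ≡ m * (a * g - c * e + d * f - b * h + + 0)
    third = solve-∀
    fourth : ∀ m a b c d e f g h →
      (m * a + e) * h - (m * d + h) * e + (m * b + f) * g - (m * c + g) * f
      ≡ m * (a * h - d * e + b * g - c * f + + 0)
    fourth = solve-∀

  descent-identity : ∀ m {P t} k y .{{_ : NonZero m}} →
    norm (m ⊛ k ⊕ y) ≡ m * P → norm y ≡ m * t →
    norm (k ⋄ y ⊕ ⟪ t , + 0 , + 0 , + 0 ⟫) ≡ t * P
  descent-identity m {P} {t} k y x≡mP y≡mt =
    ℤ.*-cancelˡ-≡ m _ _ (ℤ.*-cancelˡ-≡ m _ _ (begin
      m * (m * norm v)            ≡⟨ ℤ.*-assoc m m (norm v) ⟨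
      m * m * norm v              ≡⟨ norm-⊛ m v ⟨
      norm (m ⊛ v)                ≡⟨ cong norm (⊛⊕-⋄ m k y y≡mt) ⟨
      norm ((m ⊛ k ⊕ y) ⋄ y)      ≡⟨ norm-⋄ (m ⊛ k ⊕ y) y ⟩
      norm (m ⊛ k ⊕ y) * norm y   ≡⟨ cong₂ _*_ x≡mP y≡mt ⟩
      (m * P) * (m * t)           ≡⟨ rearrange m P t ⟩
      m * (m * (t * P))           ∎))
    where
    v = k ⋄ y ⊕ ⟪ t , + 0 , + 0 , + 0 ⟫
    rearrange : ∀ m P t → (m * P) * (m * t) ≡ m * (m * (t * P))
    rearrange = solve-∀

  norm-residue : ∀ m k y {P} → norm (m ⊛ k ⊕ y) ≡ m * P → norm y ≡ m * (P - (m * norm k + + 2 * (k · y)))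
  norm-residue m k y {P} x≡mP = begin
    norm y                   ≡⟨ cancel (m * Q) (norm y) ⟩
    (m * Q + norm y) - m * Q ≡⟨ cong (_- m * Q) (trans (sym (norm-⊛⊕ m k y)) x≡mP) ⟩
    m * P - m * Q            ≡⟨ factor m P Q ⟩
    m * (P - Q)              ∎
    where
    Q = m * norm k + + 2 * (k · y)
    cancel : ∀ a n → n ≡ (a + n) - a
    cancel = solve-∀
    factor : ∀ m p q → m * p - m * q ≡ m * (p - q)
    factor = solve-∀

  0⁴ : ℤ⁴
  0⁴ = ⟪ + 0 , + 0 , + 0 , + 0 ⟫

  ⊕-identityʳ : ∀ v → v ⊕ 0⁴ ≡ v
  ⊕-identityʳ ⟪ a , b , c , d ⟫ =
    ⟪⟫-cong (ℤ.+-identityʳ a) (ℤ.+-identityʳ b) (ℤ.+-identityʳ c) (ℤ.+-identityʳ d)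

  norm-⊛-cancel : ∀ m k {P} .{{_ : NonZero m}} → norm (m ⊛ k) ≡ m * P → m * norm k ≡ P
  norm-⊛-cancel m k {P} mk≡mP = ℤ.*-cancelˡ-≡ m _ _ (begin
    m * (m * norm k) ≡⟨ ℤ.*-assoc m m (norm k) ⟨
    m * m * norm k   ≡⟨ norm-⊛ m k ⟨
    norm (m ⊛ k)     ≡⟨ mk≡mP ⟩
    m * P            ∎)

  *-fourSquares : ∀ {m n} → FourSquares m → FourSquares n → FourSquares (m * n)
  *-fourSquares (u , refl) (v , refl) = u ⋄ v , norm-⋄ u v

module Descent where

  open Quaternions

  open import Data.Nat.Base as ℕ using (ℕ; suc; 2+)
  import Data.Nat.Properties as ℕ
  import Data.Nat.Tactic.RingSolver as ℕ
  open import Data.Nat.Primality using (Prime; composite)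
  open import Data.Nat.Divisibility using (divides)
  open import Data.Nat.Induction using (<-rec)
  open import Data.Integer.Base using (ℤ; +_; -[1+_]; -_; ∣_∣; _+_; _*_; _-_; _%ℕ_; _/ℕ_)
  import Data.Integer.Properties as ℤ
  open import Data.Integer.DivMod using (a≡a%ℕn+[a/ℕn]*n; n%ℕd<d)
  open import Data.Integer.Tactic.RingSolver using (solve-∀)
  open import Data.Product.Base using (Σ; _×_; _,_)
  open import Data.Sum.Base using ([_,_]′)
  open import Function.Base using (id)
  open import Relation.Nullary using (Dec; yes; no)
  open import Relation.Binary.PropositionalEquality

  square≡∣∣² : ∀ i → i * i ≡ + (∣ i ∣ ℕ.* ∣ i ∣)
  square≡∣∣² (+ n)    = sym (ℤ.pos-* n n)
  square≡∣∣² -[1+ n ] = refl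

  normℕ : ℤ⁴ → ℕ
  normℕ ⟪ a , b , c , d ⟫ = ∣ a ∣ ℕ.* ∣ a ∣ ℕ.+ ∣ b ∣ ℕ.* ∣ b ∣ ℕ.+ ∣ c ∣ ℕ.* ∣ c ∣ ℕ.+ ∣ d ∣ ℕ.* ∣ d ∣

  norm≡normℕ : ∀ v → norm v ≡ + normℕ v
  norm≡normℕ ⟪ a , b , c , d ⟫ = begin
    a * a + b * b + c * c + d * d
      ≡⟨ cong₂ _+_ (cong₂ _+_ (cong₂ _+_ (square≡∣∣² a) (square≡∣∣² b)) (square≡∣∣² c)) (square≡∣∣² d) ⟩
    + A + + B + + C + + D
      ≡⟨ cong (λ z → z + + C + + D) (ℤ.pos-+ A B) ⟨
    + (A ℕ.+ B) + + C + + D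
      ≡⟨ cong (λ z → z + + D) (ℤ.pos-+ (A ℕ.+ B) C) ⟨
    + (A ℕ.+ B ℕ.+ C) + + D
      ≡⟨ ℤ.pos-+ (A ℕ.+ B ℕ.+ C) D ⟨
    + (A ℕ.+ B ℕ.+ C ℕ.+ D) ∎
    where
    A = ∣ a ∣ ℕ.* ∣ a ∣
    B = ∣ b ∣ ℕ.* ∣ b ∣
    C = ∣ c ∣ ℕ.* ∣ c ∣
    D = ∣ d ∣ ℕ.* ∣ d ∣
    open ≡-Reasoning

  normℕ≡0⇒≡0⁴ : ∀ v → normℕ v ≡ 0 → v ≡ 0⁴
  normℕ≡0⇒≡0⁴ ⟪ a , b , c , d ⟫ n≡0 =
    ⟪⟫-cong (zero-square a (ℕ.m+n≡0⇒m≡0 _ ab≡0)) (zero-square b (ℕ.m+n≡0⇒n≡0 _ ab≡0))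
            (zero-square c (ℕ.m+n≡0⇒n≡0 _ abc≡0)) (zero-square d (ℕ.m+n≡0⇒n≡0 _ n≡0))
    where
    abc≡0 = ℕ.m+n≡0⇒m≡0 _ n≡0
    ab≡0  = ℕ.m+n≡0⇒m≡0 _ abc≡0
    zero-square : ∀ i → ∣ i ∣ ℕ.* ∣ i ∣ ≡ 0 → i ≡ + 0
    zero-square i sq≡0 = ℤ.∣i∣≡0⇒i≡0 ([ id , id ]′ (ℕ.m*n≡0⇒m≡0∨n≡0 ∣ i ∣ sq≡0))

  HalfBounded : ℕ → ℤ⁴ → Set
  HalfBounded m ⟪ a , b , c , d ⟫ =
    2 ℕ.* ∣ a ∣ ℕ.≤ m × 2 ℕ.* ∣ b ∣ ℕ.≤ m × 2 ℕ.* ∣ c ∣ ℕ.≤ m × 2 ℕ.* ∣ d ∣ ℕ.≤ m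

  private
    four*normℕ : ∀ a b c d → 4 ℕ.* (a ℕ.* a ℕ.+ b ℕ.* b ℕ.+ c ℕ.* c ℕ.+ d ℕ.* d)
      ≡ (2 ℕ.* a) ℕ.* (2 ℕ.* a) ℕ.+ ((2 ℕ.* b) ℕ.* (2 ℕ.* b) ℕ.+ (2 ℕ.* c) ℕ.* (2 ℕ.* c) ℕ.+ (2 ℕ.* d) ℕ.* (2 ℕ.* d))
    four*normℕ = ℕ.solve-∀

    four*square : ∀ n → 4 ℕ.* n ≡ n ℕ.+ (n ℕ.+ n ℕ.+ n)
    four*square = ℕ.solve-∀

    2*n≡n+n : ∀ n → 2 ℕ.* n ≡ n ℕ.+ n
    2*n≡n+n = ℕ.solve-∀

    square-mono : ∀ {u m} → u ℕ.≤ m → u ℕ.* u ℕ.≤ m ℕ.* m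
    square-mono u≤m = ℕ.*-mono-≤ u≤m u≤m

  normℕ≤m*m : ∀ {m} v → HalfBounded m v → normℕ v ℕ.≤ m ℕ.* m
  normℕ≤m*m {m} ⟪ a , b , c , d ⟫ (a≤ , b≤ , c≤ , d≤) = ℕ.*-cancelˡ-≤ 4 (begin
    4 ℕ.* normℕ ⟪ a , b , c , d ⟫ ≡⟨ four*normℕ (∣ a ∣) (∣ b ∣) (∣ c ∣) (∣ d ∣) ⟩
    _                            ≤⟨ ℕ.+-mono-≤ (square-mono a≤)
                                      (ℕ.+-mono-≤ (ℕ.+-mono-≤ (square-mono b≤) (square-mono c≤)) (square-mono d≤)) ⟩
    m ℕ.* m ℕ.+ (m ℕ.* m ℕ.+ m ℕ.* m ℕ.+ m ℕ.* m) ≡⟨ four*square (m ℕ.* m) ⟨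
    4 ℕ.* (m ℕ.* m) ∎)
    where open ℕ.≤-Reasoning

  normℕ≡m*m⇒2∣x₁∣≡m : ∀ {m} v → HalfBounded m v → normℕ v ≡ m ℕ.* m → 2 ℕ.* ∣ ℤ⁴.x₁ v ∣ ≡ m
  normℕ≡m*m⇒2∣x₁∣≡m {m} ⟪ a , b , c , d ⟫ (a≤ , b≤ , c≤ , d≤) v≡mm =
    ℕ.≤-antisym a≤ (square-reflects-≤ (ℕ.+-cancelʳ-≤ R (m ℕ.* m) _ (begin
      m ℕ.* m ℕ.+ R                               ≤⟨ ℕ.+-monoʳ-≤ (m ℕ.* m) R≤ ⟩
      m ℕ.* m ℕ.+ (m ℕ.* m ℕ.+ m ℕ.* m ℕ.+ m ℕ.* m) ≡⟨ four*square (m ℕ.* m) ⟨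
      4 ℕ.* (m ℕ.* m)                             ≡⟨ cong (4 ℕ.*_) v≡mm ⟨
      4 ℕ.* normℕ ⟪ a , b , c , d ⟫               ≡⟨ four*normℕ (∣ a ∣) (∣ b ∣) (∣ c ∣) (∣ d ∣) ⟩
      _ ∎)))
    where
    open ℕ.≤-Reasoning
    R = (2 ℕ.* ∣ b ∣) ℕ.* (2 ℕ.* ∣ b ∣) ℕ.+ (2 ℕ.* ∣ c ∣) ℕ.* (2 ℕ.* ∣ c ∣) ℕ.+ (2 ℕ.* ∣ d ∣) ℕ.* (2 ℕ.* ∣ d ∣)
    R≤ = ℕ.+-mono-≤ (ℕ.+-mono-≤ (square-mono b≤) (square-mono c≤)) (square-mono d≤)
    square-reflects-≤ : ∀ {m u} → m ℕ.* m ℕ.≤ u ℕ.* u → m ℕ.≤ u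
    square-reflects-≤ mm≤uu = ℕ.≮⇒≥ (λ u<m → ℕ.<⇒≱ (ℕ.*-mono-< u<m u<m) mm≤uu)

  balanced-residue : ∀ m .{{_ : ℕ.NonZero m}} x →
    Σ ℤ λ k → Σ ℤ λ y → x ≡ + m * k + y × 2 ℕ.* ∣ y ∣ ℕ.≤ m
  balanced-residue m x = choose (2 ℕ.* r ℕ.≤? m)
    where
    r = x %ℕ m
    q = x /ℕ m
    s = m ℕ.∸ r
    x≡r+qm : x ≡ + r + q * + m
    x≡r+qm = a≡a%ℕn+[a/ℕn]*n x m
    s+r≡m : s ℕ.+ r ≡ m
    s+r≡m = ℕ.m∸n+n≡m (ℕ.<⇒≤ (n%ℕd<d x m))
    choose : Dec (2 ℕ.* r ℕ.≤ m) → Σ ℤ λ k → Σ ℤ λ y → x ≡ + m * k + y × 2 ℕ.* ∣ y ∣ ℕ.≤ m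
    choose (yes 2r≤m) = q , + r , trans x≡r+qm (shuffle (+ r) q (+ m)) , 2r≤m
      where
      shuffle : ∀ r q m → r + q * m ≡ m * q + r
      shuffle = solve-∀
    choose (no 2r≰m) = q + + 1 , - + s , x≡ , 2s≤m
      where
      x≡ : x ≡ + m * (q + + 1) + - + s
      x≡ = begin
        x                                ≡⟨ x≡r+qm ⟩
        + r + q * + m                    ≡⟨ shuffle (+ r) q (+ m) ⟩
        + m * (q + + 1) + - (+ m - + r)  ≡⟨ cong (λ z → + m * (q + + 1) + - z) (trans (ℤ.m-n≡m⊖n m r) (ℤ.⊖-≥ (ℕ.<⇒≤ (n%ℕd<d x m)))) ⟩
        + m * (q + + 1) + - + s          ∎
        where
        open ≡-Reasoning
        shuffle : ∀ r q m → r + q * m ≡ m * (q + + 1) + - (m - r)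
        shuffle = solve-∀
      2s≤m : 2 ℕ.* ∣ - + s ∣ ℕ.≤ m
      2s≤m = begin
        2 ℕ.* ∣ - + s ∣ ≡⟨ cong (2 ℕ.*_) (ℤ.∣-i∣≡∣i∣ (+ s)) ⟩
        2 ℕ.* s         ≡⟨ 2*n≡n+n s ⟩
        s ℕ.+ s         ≤⟨ ℕ.+-monoʳ-≤ s (ℕ.<⇒≤ s<r) ⟩
        s ℕ.+ r         ≡⟨ s+r≡m ⟩
        m               ∎
        where
        open ℕ.≤-Reasoning
        s<r : s ℕ.< r
        s<r = ℕ.+-cancelʳ-< r s r (begin-strict
          s ℕ.+ r ≡⟨ s+r≡m ⟩
          m       <⟨ ℕ.≰⇒> 2r≰m ⟩
          2 ℕ.* r ≡⟨ 2*n≡n+n r ⟩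
          r ℕ.+ r ∎)

  balanced-residue⁴ : ∀ m .{{_ : ℕ.NonZero m}} x →
    Σ ℤ⁴ λ k → Σ ℤ⁴ λ y → x ≡ + m ⊛ k ⊕ y × HalfBounded m y
  balanced-residue⁴ m ⟪ a , b , c , d ⟫
    with balanced-residue m a | balanced-residue m b | balanced-residue m c | balanced-residue m d
  ... | k₁ , y₁ , refl , y₁≤ | k₂ , y₂ , refl , y₂≤ | k₃ , y₃ , refl , y₃≤ | k₄ , y₄ , refl , y₄≤ =
    ⟪ k₁ , k₂ , k₃ , k₄ ⟫ , ⟪ y₁ , y₂ , y₃ , y₄ ⟫ , refl , (y₁≤ , y₂≤ , y₃≤ , y₄≤)

  prime⇒≢* : ∀ {p d} → Prime p → 2 ℕ.≤ d → d ℕ.< p → ∀ k → + d * k ≢ + p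
  prime⇒≢* {p} {d} pr 2≤d d<p k dk≡p = Prime.notComposite pr (composite d<p (divides ∣ k ∣ p≡∣k∣d))
    where
    instance _ = ℕ.n>1⇒nonTrivial 2≤d
    p≡∣k∣d : p ≡ ∣ k ∣ ℕ.* d
    p≡∣k∣d = trans (cong ∣_∣ (sym dk≡p)) (trans (ℤ.abs-* (+ d) k) (ℕ.*-comm d ∣ k ∣))

  +*≡+⇒nonNegative : ∀ m .{{_ : ℕ.NonZero m}} i {n} → + m * i ≡ + n → i ≡ + ∣ i ∣
  +*≡+⇒nonNegative m         (+ _)    _  = refl
  +*≡+⇒nonNegative (suc _)   -[1+ _ ] ()

  residue-quotient-bounds : ∀ {p} → Prime p → ∀ m .{{_ : ℕ.NonTrivial m}} → m ℕ.< p → ∀ k y →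
    HalfBounded m y → norm (+ m ⊛ k ⊕ y) ≡ + m * + p → ∀ t → norm y ≡ + m * + t → 1 ℕ.≤ t × t ℕ.< m
  residue-quotient-bounds {p} pr m m<p k y y-small x≡mp t y≡mt = ℕ.n≢0⇒n>0 t≢0 , ℕ.≤∧≢⇒< t≤m t≢m
    where
    instance _ = ℕ.nonTrivial⇒nonZero m
    M = + m
    2≤m : 2 ℕ.≤ m
    2≤m = ℕ.nonTrivial⇒n>1 m
    normℕy≡mt : normℕ y ≡ m ℕ.* t
    normℕy≡mt = ℤ.+-injective (trans (sym (norm≡normℕ y)) (trans y≡mt (sym (ℤ.pos-* m t))))
    t≤m : t ℕ.≤ m
    t≤m = ℕ.*-cancelˡ-≤ m (subst (ℕ._≤ m ℕ.* m) normℕy≡mt (normℕ≤m*m y y-small))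
    t≢0 : t ≢ 0
    t≢0 t≡0 = prime⇒≢* pr 2≤m m<p (norm k) (norm-⊛-cancel M k
      (trans (cong norm (sym (⊕-identityʳ (M ⊛ k)))) (subst (λ z → norm (M ⊛ k ⊕ z) ≡ M * + p) y≡0 x≡mp)))
      where
      y≡0 : y ≡ 0⁴
      y≡0 = normℕ≡0⇒≡0⁴ y (trans normℕy≡mt (trans (cong (m ℕ.*_) t≡0) (ℕ.*-zeroʳ m)))
    -- t = m forces |yᵢ| = m/2, so m = 2u is even, and then so is p.
    t≢m : t ≢ m
    t≢m t≡m = prime⇒≢* pr ℕ.≤-refl (ℕ.≤-<-trans 2≤m m<p) _ (sym (begin
      + p                                            ≡⟨ split (+ p) Q ⟩
      Q + (+ p - Q)                                  ≡⟨ cong (λ z → Q + z) p-Q≡M ⟩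
      M * norm k + + 2 * (k · y) + M                 ≡⟨ cong (λ z → z * norm k + + 2 * (k · y) + z) M≡2u ⟩
      + 2 * + u * norm k + + 2 * (k · y) + + 2 * + u ≡⟨ factor (+ u) (norm k) (k · y) ⟩
      + 2 * (+ u * norm k + k · y + + u)             ∎))
      where
      open ≡-Reasoning
      Q = M * norm k + + 2 * (k · y)
      p-Q≡M : + p - Q ≡ M
      p-Q≡M = ℤ.*-cancelˡ-≡ M _ _ (trans (sym (norm-residue M k y x≡mp)) (trans y≡mt (cong (λ z → M * + z) t≡m)))
      u = ∣ ℤ⁴.x₁ y ∣
      M≡2u : M ≡ + 2 * + u
      M≡2u = trans (cong +_ (sym (normℕ≡m*m⇒2∣x₁∣≡m y y-small (trans normℕy≡mt (cong (m ℕ.*_) t≡m))))) (ℤ.pos-* 2 u)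
      split : ∀ p q → p ≡ q + (p - q)
      split = solve-∀
      factor : ∀ u n s → + 2 * u * n + + 2 * s + + 2 * u ≡ + 2 * (u * n + s + u)
      factor = solve-∀

  -- Reduce x modulo m to y with |yᵢ| ≤ m/2: then norm y = m t with 1 ≤ t < m, and (x ⋄ y)/m has norm t p.
  descent-step : ∀ {p} → Prime p → ∀ m .{{_ : ℕ.NonTrivial m}} → m ℕ.< p →
    FourSquares (+ m * + p) → Σ ℕ λ t → (1 ℕ.≤ t × t ℕ.< m) × FourSquares (+ t * + p)
  descent-step {p} pr m m<p (x , x≡mp) with balanced-residue⁴ m {{ℕ.nonTrivial⇒nonZero m}} x
  ... | k , y , refl , y-small =
    t , residue-quotient-bounds pr m m<p k y y-small x≡mp t y≡mt ,
    (k ⋄ y ⊕ ⟪ + t , + 0 , + 0 , + 0 ⟫ , descent-identity (+ m) k y x≡mp y≡mt)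
    where
    instance _ = ℕ.nonTrivial⇒nonZero m
    y≡mT : norm y ≡ + m * (+ p - (+ m * norm k + + 2 * (k · y)))
    y≡mT = norm-residue (+ m) k y x≡mp
    t = ∣ + p - (+ m * norm k + + 2 * (k · y)) ∣
    y≡mt : norm y ≡ + m * + t
    y≡mt = trans y≡mT (cong (+ m *_) (+*≡+⇒nonNegative m _ (trans (sym y≡mT) (norm≡normℕ y))))

  descent : ∀ {p} → Prime p → ∀ m → 1 ℕ.≤ m → m ℕ.< p → FourSquares (+ m * + p) → FourSquares (+ p)
  descent {p} pr = <-rec (λ m → 1 ℕ.≤ m → m ℕ.< p → FourSquares (+ m * + p) → FourSquares (+ p)) step
    where
    step : ∀ m → (∀ {t} → t ℕ.< m → 1 ℕ.≤ t → t ℕ.< p → FourSquares (+ t * + p) → FourSquares (+ p)) →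
           1 ℕ.≤ m → m ℕ.< p → FourSquares (+ m * + p) → FourSquares (+ p)
    step 1        _   _ _   (v , v≡p) = v , trans v≡p (ℤ.*-identityˡ (+ p))
    step m@(2+ _) rec _ m<p mp with descent-step pr m m<p mp
    ... | t , (1≤t , t<m) , tp = rec t<m 1≤t (ℕ.<-trans t<m m<p) tp

module SquaresModuloPrime where

  open Quaternions using (⟪_,_,_,_⟫; norm; FourSquares)
  open Descent using (norm≡normℕ)

  import Data.Integer.Base as ℤ
  import Data.Integer.Properties as ℤ

  open import Data.Nat.Base as ℕ using (ℕ; zero; suc; _+_; _*_; _∸_; _≤_; _<_; z≤n; s≤s; NonZero)
  import Data.Nat.Properties as ℕ
  import Data.Nat.Tactic.RingSolver as ℕ
  open import Data.Nat.DivMod using (_%_; _/_; m≡m%n+[m/n]*n; m%n<n)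
  open import Data.Nat.Divisibility using (_∣_; divides; ∣⇒≤)
  open import Data.Nat.Primality using (Prime; euclidsLemma; prime⇒nonTrivial)
  open import Data.Fin.Base using (Fin; toℕ; fromℕ<; splitAt; join)
  import Data.Fin.Properties as Fin
  open import Data.Sum.Base using (inj₁; inj₂; [_,_]′)
  open import Data.Product.Base using (Σ; ∃₂; _×_; _,_)
  open import Function.Base using (_∘_)
  open import Function.Definitions using (Injective)
  open import Relation.Nullary using (yes; no; contradiction)
  open import Relation.Binary.PropositionalEquality

  images-meet : ∀ {m n} (f g : Fin n → Fin m) → Injective _≡_ _≡_ f → Injective _≡_ _≡_ g →
    m < n + n → ∃₂ λ i j → f i ≡ g j
  images-meet {m} {n} f g f-injective g-injective m<n+n
    with Fin.any? (λ i → Fin.any? (λ j → f i Fin.≟ g j))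
  ... | yes (i , j , fi≡gj) = i , j , fi≡gj
  ... | no disjoint = contradiction (Fin.injective⇒≤ h-injective) (ℕ.<⇒≱ m<n+n)
    where
    [f,g] = [ f , g ]′
    [f,g]-injective : ∀ a b → [f,g] a ≡ [f,g] b → a ≡ b
    [f,g]-injective (inj₁ i) (inj₁ j) fi≡fj = cong inj₁ (f-injective fi≡fj)
    [f,g]-injective (inj₁ i) (inj₂ j) fi≡gj = contradiction (i , j , fi≡gj) disjoint
    [f,g]-injective (inj₂ i) (inj₁ j) gi≡fj = contradiction (j , i , sym gi≡fj) disjoint
    [f,g]-injective (inj₂ i) (inj₂ j) gi≡gj = cong inj₂ (g-injective gi≡gj)
    h : Fin (n + n) → Fin m
    h = [f,g] ∘ splitAt n
    h-injective : Injective _≡_ _≡_ h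
    h-injective {i} {j} hi≡hj = begin
      i                      ≡⟨ Fin.join-splitAt n n i ⟨
      join n n (splitAt n i) ≡⟨ cong (join n n) ([f,g]-injective (splitAt n i) (splitAt n j) hi≡hj) ⟩
      join n n (splitAt n j) ≡⟨ Fin.join-splitAt n n j ⟩
      j                      ∎
      where open ≡-Reasoning

  ∣∧<⇒≡0 : ∀ {p n} → p ∣ n → n < p → n ≡ 0
  ∣∧<⇒≡0 {n = zero}  _   _   = refl
  ∣∧<⇒≡0 {n = suc _} p∣n n<p = contradiction (∣⇒≤ p∣n) (ℕ.<⇒≱ n<p)

  private
    square-mod-injective-≤ : ∀ {p} .{{_ : NonZero p}} → Prime p → ∀ {x y} → x + y < p → y ≤ x →
      x * x % p ≡ y * y % p → x ≡ y
    square-mod-injective-≤ {p} pr {x} {y} x+y<p y≤x x²≡y² with euclidsLemma d (x + y) pr p∣d[x+y]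
      where
      d = x ∸ y
      r = y * y % p
      difference-of-squares : ∀ y d → (y + d) * (y + d) ≡ d * ((y + d) + y) + y * y
      difference-of-squares = ℕ.solve-∀
      x*x≡d[x+y]+y*y : x * x ≡ d * (x + y) + y * y
      x*x≡d[x+y]+y*y = subst (λ z → z * z ≡ d * (z + y) + y * y) (ℕ.m+[n∸m]≡n y≤x) (difference-of-squares y d)
      p∣d[x+y] : p ∣ d * (x + y)
      p∣d[x+y] = divides (x * x / p ∸ y * y / p) (begin
        d * (x + y)                                 ≡⟨ ℕ.m+n∸n≡m (d * (x + y)) (y * y) ⟨
        d * (x + y) + y * y ∸ y * y                 ≡⟨ cong₂ _∸_ (sym x*x≡d[x+y]+y*y) (m≡m%n+[m/n]*n (y * y) p) ⟩
        x * x ∸ (r + y * y / p * p)                 ≡⟨ cong (_∸ (r + y * y / p * p)) (trans (m≡m%n+[m/n]*n (x * x) p) (cong (_+ x * x / p * p) x²≡y²)) ⟩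
        (r + x * x / p * p) ∸ (r + y * y / p * p)   ≡⟨ ℕ.[m+n]∸[m+o]≡n∸o r _ _ ⟩
        x * x / p * p ∸ y * y / p * p               ≡⟨ ℕ.*-distribʳ-∸ p (x * x / p) (y * y / p) ⟨
        (x * x / p ∸ y * y / p) * p                 ∎)
        where open ≡-Reasoning
    ... | inj₁ p∣d   = ℕ.≤-antisym (ℕ.m∸n≡0⇒m≤n (∣∧<⇒≡0 p∣d (ℕ.≤-<-trans (ℕ.m∸n≤m x y) (ℕ.≤-<-trans (ℕ.m≤m+n x y) x+y<p)))) y≤x
    ... | inj₂ p∣x+y = trans (ℕ.m+n≡0⇒m≡0 x x+y≡0) (sym (ℕ.m+n≡0⇒n≡0 x x+y≡0))
      where x+y≡0 = ∣∧<⇒≡0 p∣x+y x+y<p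

  square-mod-injective : ∀ {p} .{{_ : NonZero p}} → Prime p → ∀ {x y} → x + y < p →
    x * x % p ≡ y * y % p → x ≡ y
  square-mod-injective {p} pr {x} {y} x+y<p x²≡y² with ℕ.≤-total y x
  ... | inj₁ y≤x = square-mod-injective-≤ pr x+y<p y≤x x²≡y²
  ... | inj₂ x≤y = sym (square-mod-injective-≤ pr (subst (_< p) (ℕ.+-comm x y) x+y<p) x≤y (sym x²≡y²))

  module _ {h : ℕ} (pr : Prime (suc (h + h))) where

    private
      p = suc (h + h)

      residue≤2h : ∀ n → n % p ≤ h + h
      residue≤2h n = ℕ.s≤s⁻¹ (m%n<n n p)

      square% : Fin (suc h) → Fin p
      square% a = fromℕ< (m%n<n (toℕ a * toℕ a) p)

      -1-square% : Fin (suc h) → Fin p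
      -1-square% b = fromℕ< (s≤s (ℕ.m∸n≤m (h + h) (toℕ b * toℕ b % p)))

      toℕ-sum<p : ∀ (a b : Fin (suc h)) → toℕ a + toℕ b < p
      toℕ-sum<p a b = s≤s (ℕ.+-mono-≤ (ℕ.s≤s⁻¹ (Fin.toℕ<n a)) (ℕ.s≤s⁻¹ (Fin.toℕ<n b)))

      square%-injective : Injective _≡_ _≡_ square%
      square%-injective {a} {b} eq = Fin.toℕ-injective (square-mod-injective pr (toℕ-sum<p a b)
        (Fin.fromℕ<-injective _ _ _ _ eq))

      -1-square%-injective : Injective _≡_ _≡_ -1-square%
      -1-square%-injective {a} {b} eq = Fin.toℕ-injective (square-mod-injective pr (toℕ-sum<p a b)
        (ℕ.∸-cancelˡ-≡ (residue≤2h (toℕ a * toℕ a)) (residue≤2h (toℕ b * toℕ b)) (Fin.fromℕ<-injective _ _ _ _ eq)))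

    -- x² and −1 − y² each take h + 1 distinct values modulo p = 2h + 1.
    residues-meet : Σ ℕ λ x → Σ ℕ λ y → x ≤ h × y ≤ h × x * x % p + y * y % p ≡ h + h
    residues-meet with images-meet square% -1-square% square%-injective -1-square%-injective
                                   (s≤s (ℕ.+-monoʳ-< h (ℕ.n<1+n h)))
    ... | a , b , a²≡-1-b² = toℕ a , toℕ b , ℕ.s≤s⁻¹ (Fin.toℕ<n a) , ℕ.s≤s⁻¹ (Fin.toℕ<n b) ,
      trans (cong (_+ toℕ b * toℕ b % p) (Fin.fromℕ<-injective _ _ _ _ a²≡-1-b²))
            (ℕ.m∸n+n≡m (residue≤2h (toℕ b * toℕ b)))

    odd-prime-multiple : Σ ℕ λ m → (1 ≤ m × m < suc (h + h)) × FourSquares (ℤ.+ m ℤ.* ℤ.+ suc (h + h))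
    odd-prime-multiple with residues-meet
    ... | x , y , x≤h , y≤h , ra+rb≡2h = m , (s≤s z≤n , m<p) , (⟪ ℤ.+ x , ℤ.+ y , ℤ.+ 1 , ℤ.+ 0 ⟫ , norm≡mp)
      where
      ra = x * x % p
      rb = y * y % p
      m = suc (x * x / p + y * y / p)
      x²+y²+1≡mp : x * x + y * y + 1 ≡ m * p
      x²+y²+1≡mp = begin
        x * x + y * y + 1                                           ≡⟨ cong₂ (λ u v → u + v + 1) (m≡m%n+[m/n]*n (x * x) p) (m≡m%n+[m/n]*n (y * y) p) ⟩
        (ra + x * x / p * p) + (rb + y * y / p * p) + 1             ≡⟨ cong (λ n → (ra + x * x / p * suc n) + (rb + y * y / p * suc n) + 1) ra+rb≡2h ⟨
        (ra + x * x / p * suc (ra + rb)) + (rb + y * y / p * suc (ra + rb)) + 1 ≡⟨ collect ra rb (x * x / p) (y * y / p) ⟩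
        m * suc (ra + rb)                                           ≡⟨ cong (λ n → m * suc n) ra+rb≡2h ⟩
        m * p                                                       ∎
        where
        open ≡-Reasoning
        collect : ∀ ra rb qa qb → (ra + qa * suc (ra + rb)) + (rb + qb * suc (ra + rb)) + 1 ≡ suc (qa + qb) * suc (ra + rb)
        collect = ℕ.solve-∀
      norm≡mp : norm ⟪ ℤ.+ x , ℤ.+ y , ℤ.+ 1 , ℤ.+ 0 ⟫ ≡ ℤ.+ m ℤ.* ℤ.+ p
      norm≡mp = trans (norm≡normℕ ⟪ ℤ.+ x , ℤ.+ y , ℤ.+ 1 , ℤ.+ 0 ⟫)
                      (trans (cong ℤ.+_ (trans (ℕ.+-identityʳ _) x²+y²+1≡mp)) (ℤ.pos-* m p))
      m<p : m < p
      m<p = ℕ.*-cancelʳ-< p m p (begin-strict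
        m * p                                           ≡⟨ x²+y²+1≡mp ⟨
        x * x + y * y + 1                               ≤⟨ ℕ.+-monoˡ-≤ 1 (ℕ.+-mono-≤ (ℕ.*-mono-≤ x≤h x≤h) (ℕ.*-mono-≤ y≤h y≤h)) ⟩
        h * h + h * h + 1                               <⟨ ℕ.m<m+n _ (ℕ.≤-trans 0<h (ℕ.m≤n+m h _)) ⟩
        (h * h + h * h + 1) + (2 * (h * h) + 3 * h + h) ≡⟨ expand h ⟩
        p * p                                           ∎)
        where
        open ℕ.≤-Reasoning
        0<h : 0 < h
        0<h = half-positive (ℕ.s<s⁻¹ (ℕ.nonTrivial⇒n>1 p {{prime⇒nonTrivial pr}}))
          where
          half-positive : ∀ {n} → 0 < n + n → 0 < n
          half-positive {suc _} _ = s≤s z≤n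
        expand : ∀ h → (h * h + h * h + 1) + (2 * (h * h) + 3 * h + h) ≡ suc (h + h) * suc (h + h)
        expand = ℕ.solve-∀

module FourSquareTheorem where

  open Quaternions
  open Descent
  open SquaresModuloPrime

  open import Data.Nat.Base as ℕ using (ℕ; zero; suc; _+_; z≤n; s≤s; 2+)
  import Data.Nat.Properties as ℕ
  open import Data.Nat.ListAction using (product)
  open import Data.Nat.Primality using (Prime; composite; prime⇒nonTrivial)
  open import Data.Nat.Primality.Factorisation using (factorise; PrimeFactorisation)
  open import Data.Nat.Divisibility using (_∣_; divides)
  open import Data.List.Base using ([]; _∷_)
  open import Data.List.Relation.Unary.All using (All; []; _∷_)
  import Data.Integer.Base as ℤ
  import Data.Integer.Properties as ℤ
  open import Data.Sum.Base using (_⊎_; inj₁; inj₂)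
  open import Data.Product.Base using (Σ; _,_; _×_)
  open import Function.Base using (_∘_)
  open import Relation.Nullary using (contradiction)
  open import Relation.Binary.PropositionalEquality

  parity : ∀ n → Σ ℕ λ h → n ≡ h + h ⊎ n ≡ suc (h + h)
  parity zero = zero , inj₁ refl
  parity (suc n) with parity n
  ... | h , inj₁ n≡h+h   = h , inj₂ (cong suc n≡h+h)
  ... | h , inj₂ n≡1+h+h = suc h , inj₁ (cong suc (trans n≡1+h+h (sym (ℕ.+-suc h h))))

  odd-prime⇒fourSquares : ∀ {h} → Prime (suc (h + h)) → FourSquares (ℤ.+ suc (h + h))
  odd-prime⇒fourSquares {h} pr =
    let m , (1≤m , m<p) , mp = odd-prime-multiple {h} pr in descent pr m 1≤m m<p mp

  prime⇒fourSquares : ∀ {p} → Prime p → FourSquares (ℤ.+ p)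
  prime⇒fourSquares {p} pr with parity p
  ... | h , inj₂ refl = odd-prime⇒fourSquares {h} pr
  ... | 0 , inj₁ refl = contradiction (ℕ.nonTrivial⇒n>1 0 {{prime⇒nonTrivial pr}}) λ ()
  ... | 1 , inj₁ refl = ⟪ ℤ.+ 1 , ℤ.+ 1 , ℤ.+ 0 , ℤ.+ 0 ⟫ , refl
  ... | h@(2+ _) , inj₁ refl = contradiction (composite {d = 2} 2<h+h 2∣h+h) (Prime.notComposite pr)
    where
    2<h+h : 2 ℕ.< h + h
    2<h+h = ℕ.+-mono-≤ (s≤s (s≤s z≤n)) (s≤s z≤n)
    2∣h+h : 2 ∣ h + h
    2∣h+h = divides h (sym (trans (ℕ.*-comm h 2) (cong (h +_) (ℕ.+-identityʳ h))))

  fourSquares : ∀ n → FourSquares (ℤ.+ n)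
  fourSquares zero = 0⁴ , refl
  fourSquares n@(suc _) = subst (FourSquares ∘ ℤ.+_) (sym isFactorisation) (product-fourSquares factorsPrime)
    where
    open PrimeFactorisation (factorise n)
    product-fourSquares : ∀ {ps} → All Prime ps → FourSquares (ℤ.+ product ps)
    product-fourSquares [] = ⟪ ℤ.+ 1 , ℤ.+ 0 , ℤ.+ 0 , ℤ.+ 0 ⟫ , refl
    product-fourSquares {p ∷ ps} (pr ∷ prs) =
      subst FourSquares (sym (ℤ.pos-* p (product ps))) (*-fourSquares (prime⇒fourSquares pr) (product-fourSquares prs))

module GramRealisation where

  open Quaternions using (⟪_,_,_,_⟫)
  open Descent using (norm≡normℕ)
  open FourSquareTheorem using (fourSquares)

  open import Data.Nat.Base using (ℕ; zero; suc; _+_; _*_; _∸_; _≤_; _<_; z≤n; s≤s)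
  open import Data.Nat.Properties
  open import Data.Nat.Induction using (<-rec)
  import Data.Nat.Tactic.RingSolver as ℕ
  import Data.Integer.Base as ℤ
  import Data.Integer.Properties as ℤ
  open import Data.Vec.Base using (Vec; []; _∷_; _++_; replicate; zipWith)
  open import Data.Vec.Relation.Binary.Pointwise.Inductive using (Pointwise; []; _∷_; ++⁺)
  open import Data.Product.Base using (Σ; _×_; _,_)
  open import Data.Sum.Base using (inj₁; inj₂)
  open import Relation.Nullary using (yes; no)
  open import Relation.Binary.PropositionalEquality

  dot : ∀ {n} → Vec ℕ n → Vec ℕ n → ℕ
  dot []       []       = 0
  dot (x ∷ xs) (y ∷ ys) = x * y + dot xs ys

  infix 4 _≤ᵛ_
  _≤ᵛ_ : ∀ {n} → Vec ℕ n → Vec ℕ n → Set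
  _≤ᵛ_ = Pointwise _≤_

  private
    interchange : ∀ a b c d → (a + b) + (c + d) ≡ (a + c) + (b + d)
    interchange = ℕ.solve-∀

  dot-comm : ∀ {n} (u v : Vec ℕ n) → dot u v ≡ dot v u
  dot-comm []       []       = refl
  dot-comm (x ∷ xs) (y ∷ ys) = cong₂ _+_ (*-comm x y) (dot-comm xs ys)

  dot-++ : ∀ {m n} (u v : Vec ℕ m) (u′ v′ : Vec ℕ n) → dot (u ++ u′) (v ++ v′) ≡ dot u v + dot u′ v′
  dot-++ []       []       u′ v′ = refl
  dot-++ (x ∷ xs) (y ∷ ys) u′ v′ = trans (cong (x * y +_) (dot-++ xs ys u′ v′)) (sym (+-assoc (x * y) _ _))

  dot-zeroʳ : ∀ {n} (u : Vec ℕ n) → dot u (replicate n 0) ≡ 0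
  dot-zeroʳ []       = refl
  dot-zeroʳ (x ∷ xs) = cong₂ _+_ (*-zeroʳ x) (dot-zeroʳ xs)

  dot-distribˡ-+ : ∀ {n} (u v w : Vec ℕ n) → dot u (zipWith _+_ v w) ≡ dot u v + dot u w
  dot-distribˡ-+ []       []       []       = refl
  dot-distribˡ-+ (x ∷ xs) (y ∷ ys) (z ∷ zs) =
    trans (cong₂ _+_ (*-distribˡ-+ x y z) (dot-distribˡ-+ xs ys zs)) (interchange (x * y) (x * z) _ _)

  dot-distribʳ-+ : ∀ {n} (u v w : Vec ℕ n) → dot (zipWith _+_ v w) u ≡ dot v u + dot w u
  dot-distribʳ-+ u v w = begin
    dot (zipWith _+_ v w) u ≡⟨ dot-comm (zipWith _+_ v w) u ⟩
    dot u (zipWith _+_ v w) ≡⟨ dot-distribˡ-+ u v w ⟩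
    dot u v + dot u w       ≡⟨ cong₂ _+_ (dot-comm u v) (dot-comm u w) ⟩
    dot v u + dot w u       ∎
    where open ≡-Reasoning

  dot-∸ : ∀ {n} (p q : Vec ℕ n) → q ≤ᵛ p → dot p (zipWith _∸_ p q) + dot p q ≡ dot p p
  dot-∸ []       []       []           = refl
  dot-∸ (x ∷ xs) (y ∷ ys) (y≤x ∷ q≤p) =
    trans (interchange (x * (x ∸ y)) _ (x * y) _)
      (cong₂ _+_ (trans (sym (*-distribˡ-+ x (x ∸ y) y)) (cong (x *_) (m∸n+n≡m y≤x))) (dot-∸ xs ys q≤p))

  ∸-≤ᵛ : ∀ {n} (p q : Vec ℕ n) → zipWith _∸_ p q ≤ᵛ p
  ∸-≤ᵛ []       []       = []
  ∸-≤ᵛ (x ∷ xs) (y ∷ ys) = m∸n≤m x y ∷ ∸-≤ᵛ xs ys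

  replicate-≤ᵛ : ∀ {n} (u : Vec ℕ n) → replicate n 0 ≤ᵛ u
  replicate-≤ᵛ []       = []
  replicate-≤ᵛ (x ∷ xs) = z≤n ∷ replicate-≤ᵛ xs

  dot-monoˡ-≤ᵛ : ∀ {n} (p q : Vec ℕ n) → q ≤ᵛ p → dot q q ≤ dot p q
  dot-monoˡ-≤ᵛ []       []       []           = z≤n
  dot-monoˡ-≤ᵛ (x ∷ xs) (y ∷ ys) (y≤x ∷ q≤p) = +-mono-≤ (*-monoˡ-≤ y y≤x) (dot-monoˡ-≤ᵛ xs ys q≤p)

  sum-of-four-squares : ∀ n → Σ (Vec ℕ 4) λ r → dot r r ≡ n
  sum-of-four-squares n with fourSquares n
  ... | v@(⟪ a , b , c , d ⟫) , v≡n =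
    ℤ.∣ a ∣ ∷ ℤ.∣ b ∣ ∷ ℤ.∣ c ∣ ∷ ℤ.∣ d ∣ ∷ [] ,
    trans (reassoc (ℤ.∣ a ∣ * ℤ.∣ a ∣) (ℤ.∣ b ∣ * ℤ.∣ b ∣) (ℤ.∣ c ∣ * ℤ.∣ c ∣) (ℤ.∣ d ∣ * ℤ.∣ d ∣))
          (ℤ.+-injective (trans (sym (norm≡normℕ v)) v≡n))
    where
    reassoc : ∀ a b c d → a + (b + (c + (d + 0))) ≡ a + b + c + d
    reassoc = ℕ.solve-∀

  square-decomposition : ∀ b → Σ ℕ λ m → Σ ℕ λ r → b ≡ m * m + r × r ≤ m + m
  square-decomposition zero = 0 , 0 , refl , z≤n
  square-decomposition (suc b) with square-decomposition b
  ... | m , r , b≡ , r≤2m with m≤n⇒m<n∨m≡n r≤2m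
  ...   | inj₁ r<2m  = m , suc r , trans (cong suc b≡) (sym (+-suc (m * m) r)) , r<2m
  ...   | inj₂ r≡2m = suc m , 0 , trans (cong suc (trans b≡ (cong (m * m +_) r≡2m))) (next-square m) , z≤n
    where
    next-square : ∀ m → suc (m * m + (m + m)) ≡ suc m * suc m + 0
    next-square = ℕ.solve-∀

  SquareSplit : ℕ → Set
  SquareSplit b = Σ (Vec ℕ 2) λ p → Σ (Vec ℕ 2) λ q → dot p q ≡ b × q ≤ᵛ p × dot p p ≤ b + b

  square-split-exact : ∀ m → SquareSplit (m * m + 0)
  square-split-exact m = m ∷ 0 ∷ [] , m ∷ 0 ∷ [] , refl , ≤-refl ∷ z≤n ∷ [] , m≤m+n _ _

  square-split-below : ∀ m r → 1 ≤ r → r ≤ m → SquareSplit (m * m + r)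
  square-split-below m r 1≤r r≤m = m ∷ r ∷ [] , m ∷ 1 ∷ [] , shape m r , ≤-refl ∷ 1≤r ∷ [] , (begin
    m * m + (r * r + 0)         ≡⟨ cong (m * m +_) (+-identityʳ (r * r)) ⟩
    m * m + r * r               ≤⟨ +-monoʳ-≤ (m * m) (≤-trans (*-mono-≤ r≤m r≤m) (m≤m+n (m * m) (r + r))) ⟩
    m * m + (m * m + (r + r))   ≡⟨ regroup m r ⟩
    (m * m + r) + (m * m + r)   ∎)
    where
    open ≤-Reasoning
    shape : ∀ m r → m * m + (r * 1 + 0) ≡ m * m + r
    shape = ℕ.solve-∀
    regroup : ∀ m r → m * m + (m * m + (r + r)) ≡ (m * m + r) + (m * m + r)
    regroup = ℕ.solve-∀

  square-split-above : ∀ m r → 1 ≤ r → r ≤ m → SquareSplit (m * m + (m + r))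
  square-split-above m r 1≤r r≤m = suc m ∷ r ∷ [] , m ∷ 1 ∷ [] , shape m r , n≤1+n m ∷ 1≤r ∷ [] , (begin
    suc m * suc m + (r * r + 0)             ≡⟨ expand m r ⟩
    (m * m + m + m) + (1 + r * r)           ≤⟨ +-monoʳ-≤ (m * m + m + m)
                                                 (+-mono-≤ (≤-trans 1≤r (m≤m+n r r)) (*-mono-≤ r≤m r≤m)) ⟩
    (m * m + m + m) + ((r + r) + m * m)     ≡⟨ regroup m r ⟩
    (m * m + (m + r)) + (m * m + (m + r))   ∎)
    where
    open ≤-Reasoning
    shape : ∀ m r → suc m * m + (r * 1 + 0) ≡ m * m + (m + r)
    shape = ℕ.solve-∀
    expand : ∀ m r → suc m * suc m + (r * r + 0) ≡ (m * m + m + m) + (1 + r * r)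
    expand = ℕ.solve-∀
    regroup : ∀ m r → (m * m + m + m) + ((r + r) + m * m) ≡ (m * m + (m + r)) + (m * m + (m + r))
    regroup = ℕ.solve-∀

  square-split : ∀ b → SquareSplit b
  square-split b with square-decomposition b
  ... | m , zero , refl , _ = square-split-exact m
  ... | m , r@(suc _) , refl , r≤2m with r ≤? m
  ...   | yes r≤m = square-split-below m r (s≤s z≤n) r≤m
  ...   | no r≰m  = subst (λ z → SquareSplit (m * m + z)) m+r′≡r (square-split-above m r′ 1≤r′ r′≤m)
    where
    r′ = r ∸ m
    m+r′≡r : m + r′ ≡ r
    m+r′≡r = m+[n∸m]≡n (<⇒≤ (≰⇒> r≰m))
    r′≤m : r′ ≤ m
    r′≤m = +-cancelˡ-≤ m r′ m (subst (_≤ m + m) (sym m+r′≡r) r≤2m)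
    1≤r′ : 1 ≤ r′
    1≤r′ = +-cancelˡ-≤ m 1 r′ (subst₂ _≤_ (+-comm 1 m) (sym m+r′≡r) (≰⇒> r≰m))

  record DominatedPair (n a b : ℕ) : Set where
    constructor dominated
    field
      p q : Vec ℕ n
      p·p : dot p p ≡ a
      p·q : dot p q ≡ b
      q≤p : q ≤ᵛ p

  small-split : ∀ {a b} → b + b ≤ a → DominatedPair 6 a b
  small-split {a} {b} 2b≤a with square-split b
  ... | p , q , p·q≡b , q≤p , p·p≤2b with sum-of-four-squares (a ∸ dot p p)
  ...   | r , r·r≡ = dominated (p ++ r) (q ++ replicate 4 0) p·p≡a p·q≡b′ (++⁺ q≤p (replicate-≤ᵛ r))
    where
    p·p≡a : dot (p ++ r) (p ++ r) ≡ a
    p·p≡a = trans (dot-++ p p r r) (trans (cong (dot p p +_) r·r≡) (m+[n∸m]≡n (≤-trans p·p≤2b 2b≤a)))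
    p·q≡b′ : dot (p ++ r) (q ++ replicate 4 0) ≡ b
    p·q≡b′ = trans (dot-++ p q r (replicate 4 0)) (trans (cong₂ _+_ p·q≡b (dot-zeroʳ r)) (+-identityʳ b))

  complement-split : ∀ {n a b} → b ≤ a → DominatedPair n a (a ∸ b) → DominatedPair n a b
  complement-split {a = a} {b} b≤a (dominated p q p·p≡a p·q≡a-b q≤p) =
    dominated p (zipWith _∸_ p q) p·p≡a p·[p-q]≡b (∸-≤ᵛ p q)
    where
    p·[p-q]≡b : dot p (zipWith _∸_ p q) ≡ b
    p·[p-q]≡b = +-cancelʳ-≡ _ _ _ (begin
      dot p (zipWith _∸_ p q) + (a ∸ b) ≡⟨ cong (dot p (zipWith _∸_ p q) +_) p·q≡a-b ⟨
      dot p (zipWith _∸_ p q) + dot p q ≡⟨ dot-∸ p q q≤p ⟩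
      dot p p                           ≡⟨ p·p≡a ⟩
      a                                 ≡⟨ m+[n∸m]≡n b≤a ⟨
      b + (a ∸ b)                       ∎)
      where open ≡-Reasoning

  split : ∀ {a b} → b ≤ a → DominatedPair 6 a b
  split {a} {b} b≤a with b + b ≤? a
  ... | yes 2b≤a = small-split 2b≤a
  ... | no 2b≰a  = complement-split b≤a (small-split 2d≤a)
    where
    d = a ∸ b
    d+b≡a : d + b ≡ a
    d+b≡a = m∸n+n≡m b≤a
    d<b : d < b
    d<b = +-cancelʳ-< b d b (subst (_< b + b) (sym d+b≡a) (≰⇒> 2b≰a))
    2d≤a : d + d ≤ a
    2d≤a = ≤-trans (+-monoʳ-≤ d (<⇒≤ d<b)) (≤-reflexive d+b≡a)

  record Gram (k a b c : ℕ) : Set where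
    constructor gram
    field
      x y : Vec ℕ k
      x·x : dot x x ≡ a
      x·y : dot x y ≡ b
      y·y : dot y y ≡ c

  gram-swap : ∀ {k a b c} → Gram k a b c → Gram k c b a
  gram-swap (gram x y x·x x·y y·y) = gram y x y·y (trans (dot-comm y x) x·y) x·x

  gram-shear : ∀ {k a s c} → Gram k a s c → Gram k a (a + s) (a + (s + s) + c)
  gram-shear {a = a} {s} {c} (gram x y x·x x·y y·y) = gram x (zipWith _+_ x y) x·x x·[x+y] [x+y]·[x+y]
    where
    x·[x+y] : dot x (zipWith _+_ x y) ≡ a + s
    x·[x+y] = trans (dot-distribˡ-+ x x y) (cong₂ _+_ x·x x·y)
    [x+y]·[x+y] : dot (zipWith _+_ x y) (zipWith _+_ x y) ≡ a + (s + s) + c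
    [x+y]·[x+y] = begin
      dot (zipWith _+_ x y) (zipWith _+_ x y)   ≡⟨ dot-distribʳ-+ (zipWith _+_ x y) x y ⟩
      dot x (zipWith _+_ x y) + dot y (zipWith _+_ x y) ≡⟨ cong₂ _+_ x·[x+y] (dot-distribˡ-+ y x y) ⟩
      (a + s) + (dot y x + dot y y)             ≡⟨ cong (λ z → (a + s) + (z + dot y y)) (trans (dot-comm y x) x·y) ⟩
      (a + s) + (s + dot y y)                   ≡⟨ cong (λ z → (a + s) + (s + z)) y·y ⟩
      (a + s) + (s + c)                         ≡⟨ regroup a s c ⟩
      a + (s + s) + c                           ∎
      where
      open ≡-Reasoning
      regroup : ∀ a s c → (a + s) + (s + c) ≡ a + (s + s) + c
      regroup = ℕ.solve-∀

  diagonally-dominant⇒gram : ∀ {a b c} → b ≤ a → b ≤ c → Gram 10 a b c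
  diagonally-dominant⇒gram {a} {b} {c} b≤a b≤c with split b≤a
  ... | dominated p q p·p≡a p·q≡b q≤p with sum-of-four-squares (c ∸ dot q q)
  ...   | r , r·r≡ = gram (p ++ replicate 4 0) (q ++ r) x·x x·y y·y
    where
    q·q≤c : dot q q ≤ c
    q·q≤c = ≤-trans (dot-monoˡ-≤ᵛ p q q≤p) (subst (_≤ c) (sym p·q≡b) b≤c)
    x·x : dot (p ++ replicate 4 0) (p ++ replicate 4 0) ≡ a
    x·x = trans (dot-++ p p _ _) (trans (cong₂ _+_ p·p≡a (dot-zeroʳ (replicate 4 0))) (+-identityʳ a))
    x·y : dot (p ++ replicate 4 0) (q ++ r) ≡ b
    x·y = trans (dot-++ p q _ r) (trans (cong₂ _+_ p·q≡b (trans (dot-comm _ r) (dot-zeroʳ r))) (+-identityʳ b))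
    y·y : dot (q ++ r) (q ++ r) ≡ c
    y·y = trans (dot-++ q q r r) (trans (cong (dot q q +_) r·r≡) (m+[n∸m]≡n q·q≤c))

  shear-bound : ∀ {a s c} → 0 < s → (a + s) * (a + s) ≤ a * c → a + (s + s) ≤ c
  shear-bound {zero}    {suc _}     _ ()
  shear-bound {a@(suc _)} {s} {c} _ det = *-cancelˡ-≤ a (begin
    a * (a + (s + s))         ≤⟨ m≤m+n _ (s * s) ⟩
    a * (a + (s + s)) + s * s ≡⟨ square-expansion a s ⟨
    (a + s) * (a + s)         ≤⟨ det ⟩
    a * c                     ∎)
    where
    open ≤-Reasoning
    square-expansion : ∀ a s → (a + s) * (a + s) ≡ a * (a + (s + s)) + s * s
    square-expansion = ℕ.solve-∀

  shear-determinant : ∀ a s c′ → (a + s) * (a + s) ≤ a * (a + (s + s) + c′) → s * s ≤ a * c′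
  shear-determinant a s c′ det = +-cancelˡ-≤ (a * (a + (s + s))) _ _
    (subst₂ _≤_ (square-expansion a s) (distrib a (a + (s + s)) c′) det)
    where
    square-expansion : ∀ a s → (a + s) * (a + s) ≡ a * (a + (s + s)) + s * s
    square-expansion = ℕ.solve-∀
    distrib : ∀ a k c′ → a * (k + c′) ≡ a * k + a * c′
    distrib = ℕ.solve-∀

  gram-shear-reduction : ∀ {k a b c} → a < b → b * b ≤ a * c →
    (∀ {s c′} → c′ < c → s * s ≤ a * c′ → Gram k a s c′) → Gram k a b c
  gram-shear-reduction {k} {a} {b} {c} a<b det reduced =
    subst₂ (Gram k a) a+s≡b K+c′≡c (gram-shear (reduced c′<c (shear-determinant a s c′ det′)))
    where
    s = b ∸ a
    a+s≡b : a + s ≡ b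
    a+s≡b = m+[n∸m]≡n (<⇒≤ a<b)
    0<s : 0 < s
    0<s = +-cancelˡ-< a 0 s (subst₂ _<_ (sym (+-identityʳ a)) (sym a+s≡b) a<b)
    K≤c : a + (s + s) ≤ c
    K≤c = shear-bound {a} 0<s (subst (λ z → z * z ≤ a * c) (sym a+s≡b) det)
    c′ = c ∸ (a + (s + s))
    K+c′≡c : a + (s + s) + c′ ≡ c
    K+c′≡c = m+[n∸m]≡n K≤c
    det′ : (a + s) * (a + s) ≤ a * (a + (s + s) + c′)
    det′ = subst₂ (λ u v → u * u ≤ a * v) (sym a+s≡b) (sym K+c′≡c) det
    c′<c : c′ < c
    c′<c = subst (c′ <_) K+c′≡c (m<n+m c′ (≤-trans 0<s (≤-trans (m≤m+n s s) (m≤n+m (s + s) a))))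

  det⇒gram : ∀ a b c → b * b ≤ a * c → Gram 10 a b c
  det⇒gram a b c = <-rec P step (a + c) refl
    where
    P : ℕ → Set
    P n = ∀ {a b c} → a + c ≡ n → b * b ≤ a * c → Gram 10 a b c
    step : ∀ n → (∀ {m} → m < n → P m) → P n
    step _ rec {a} {b} {c} refl det with b ≤? a | b ≤? c
    ... | yes b≤a | yes b≤c = diagonally-dominant⇒gram b≤a b≤c
    ... | no b≰a  | _       = gram-shear-reduction (≰⇒> b≰a) det
                                (λ c′<c → rec (+-monoʳ-< a c′<c) refl)
    ... | yes _   | no b≰c  = gram-swap (gram-shear-reduction (≰⇒> b≰c) (subst (b * b ≤_) (*-comm a c) det)
                                (λ {_} {a′} a′<a → rec (subst (c + a′ <_) (+-comm c a) (+-monoʳ-< c a′<a)) refl))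

module QuadraticForm where

  import Data.Nat.Base as ℕ
  import Data.Integer.Base as ℤ
  import Data.Integer.Properties as ℤ
  open import Data.Rational.Base as ℚ using (ℚ; mkℚ; 0ℚ; _+_; _*_; -_; _≤_)
  import Data.Rational.Properties as ℚ
  open import Data.Rational.Solver using (module +-*-Solver)
  open import Data.Nat.Coprimality using (1-coprimeTo; sym)
  open import Data.Fin.Base using (Fin; zero; suc)
  open import Relation.Binary.PropositionalEquality hiding (sym)
  import Relation.Binary.PropositionalEquality as ≡

  toℚ≡mkℚ : ∀ n → toℚ n ≡ mkℚ (ℤ.+ n) 0 (sym (1-coprimeTo n))
  toℚ≡mkℚ n = ℚ.normalize-coprime (sym (1-coprimeTo n))

  toℚ-+ : ∀ m n → toℚ (m ℕ.+ n) ≡ toℚ m + toℚ n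
  toℚ-+ m n = begin
    toℚ (m ℕ.+ n)                                 ≡⟨ cong (ℚ._/ 1) (trans (ℤ.pos-+ m n) (≡.sym (cong₂ ℤ._+_ (ℤ.*-identityʳ (ℤ.+ m)) (ℤ.*-identityʳ (ℤ.+ n))))) ⟩
    (ℤ.+ m ℤ.* ℤ.+ 1 ℤ.+ ℤ.+ n ℤ.* ℤ.+ 1) ℚ./ 1    ≡⟨ cong₂ _+_ (toℚ≡mkℚ m) (toℚ≡mkℚ n) ⟨
    toℚ m + toℚ n                                 ∎
    where
    open ≡-Reasoning

  toℚ-* : ∀ m n → toℚ (m ℕ.* n) ≡ toℚ m * toℚ n
  toℚ-* m n = trans (cong (ℚ._/ 1) (ℤ.pos-* m n)) (≡.sym (cong₂ _*_ (toℚ≡mkℚ m) (toℚ≡mkℚ n)))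

  toℚ-cancel-≤ : ∀ {m n} → toℚ m ≤ toℚ n → m ℕ.≤ n
  toℚ-cancel-≤ {m} {n} m≤n = ℤ.drop‿+≤+ (subst₂ ℤ._≤_ (ℤ.*-identityʳ (ℤ.+ m)) (ℤ.*-identityʳ (ℤ.+ n))
    (ℚ.drop-*≤* (subst₂ _≤_ (toℚ≡mkℚ m) (toℚ≡mkℚ n) m≤n)))

  psd⇒quadratic : (A : Mat 2 2) → Symmetric A → PSD A → ∀ u v →
    let a = A zero zero; b = A zero (suc zero); c = A (suc zero) (suc zero) in
    b ℕ.* u ℕ.* v ℕ.+ b ℕ.* u ℕ.* v ℕ.≤ a ℕ.* u ℕ.* u ℕ.+ c ℕ.* v ℕ.* v
  psd⇒quadratic A symmetric psd u v = toℚ-cancel-≤ (begin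
    toℚ (b ℕ.* u ℕ.* v ℕ.+ b ℕ.* u ℕ.* v)     ≡⟨ toℚ-+ (b ℕ.* u ℕ.* v) (b ℕ.* u ℕ.* v) ⟩
    toℚ (b ℕ.* u ℕ.* v) + toℚ (b ℕ.* u ℕ.* v) ≡⟨ cong₂ _+_ (toℚ-*³ b u v) (toℚ-*³ b u v) ⟩
    Y                                         ≡⟨ ℚ.+-identityʳ Y ⟨
    Y + 0ℚ                                    ≤⟨ ℚ.+-monoʳ-≤ Y (psd x) ⟩
    Y + form A′ B′ (toℚ (A (suc zero) zero)) C′ U V ≡⟨ cong (λ z → Y + form A′ B′ (toℚ z) C′ U V) (symmetric (suc zero) zero) ⟩
    Y + form A′ B′ B′ C′ U V                  ≡⟨ psd-identity A′ B′ C′ U V ⟩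
    A′ * U * U + C′ * V * V                   ≡⟨ cong₂ _+_ (toℚ-*³ a u u) (toℚ-*³ c v v) ⟨
    toℚ (a ℕ.* u ℕ.* u) + toℚ (c ℕ.* v ℕ.* v) ≡⟨ toℚ-+ (a ℕ.* u ℕ.* u) (c ℕ.* v ℕ.* v) ⟨
    toℚ (a ℕ.* u ℕ.* u ℕ.+ c ℕ.* v ℕ.* v)     ∎)
    where
    open ℚ.≤-Reasoning
    open +-*-Solver
    a = A zero zero
    b = A zero (suc zero)
    c = A (suc zero) (suc zero)
    A′ = toℚ a
    B′ = toℚ b
    C′ = toℚ c
    U = toℚ u
    V = toℚ v
    x : Fin 2 → ℚ
    x zero    = U
    x (suc _) = - V
    Y = B′ * U * V + B′ * U * V
    -- The quadratic form of [[a₀₀, a₀₁], [a₁₀, a₁₁]] at (s, − t), in the shape PSD unfolds to.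
    form : ℚ → ℚ → ℚ → ℚ → ℚ → ℚ → ℚ
    form a₀₀ a₀₁ a₁₀ a₁₁ s t =
      s * (a₀₀ * s) + (s * (a₀₁ * (- t)) + 0ℚ) + ((- t) * (a₁₀ * s) + ((- t) * (a₁₁ * (- t)) + 0ℚ) + 0ℚ)
    toℚ-*³ : ∀ l m n → toℚ (l ℕ.* m ℕ.* n) ≡ toℚ l * toℚ m * toℚ n
    toℚ-*³ l m n = trans (toℚ-* (l ℕ.* m) n) (cong (_* toℚ n) (toℚ-* l m))
    psd-identity : ∀ α β γ s t → β * s * t + β * s * t + form α β β γ s t ≡ α * s * s + γ * t * t
    psd-identity = solve 5 (λ α β γ s t →
      β :* s :* t :+ β :* s :* t :+ (s :* (α :* s) :+ (s :* (β :* (:- t)) :+ con 0ℚ)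
                                     :+ ((:- t) :* (β :* s) :+ ((:- t) :* (γ :* (:- t)) :+ con 0ℚ) :+ con 0ℚ))
      := α :* s :* s :+ γ :* t :* t) refl

open import Data.Nat.Base using (ℕ; zero; suc; _*_; _+_; _≤_; z≤n)
open import Data.Nat.Properties
import Data.Nat.Tactic.RingSolver as ℕ
open import Data.Fin.Base using (zero; suc)
open import Data.Vec.Base using (Vec; []; _∷_; lookup)
open import Relation.Nullary using (contradiction)
open GramRealisation using (dot; dot-comm; Gram; det⇒gram)
open QuadraticForm using (psd⇒quadratic)

-- Take (u, v) = (c, b); if c = 0, then (u, v) = (1, a + 1) forces b = 0.
quadratic⇒det : ∀ a b c → (∀ u v → b * u * v + b * u * v ≤ a * u * u + c * v * v) → b * b ≤ a * c
quadratic⇒det a zero    zero      _ = z≤n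
quadratic⇒det a (suc b) zero      q = contradiction (q 1 (suc a)) (<⇒≱ (begin-strict
  a * 1 * 1 + 0 * suc a * suc a         ≡⟨ simplify a (suc a) ⟩
  a                                     <⟨ n<1+n a ⟩
  suc a                                 ≤⟨ m≤n*m (suc a) (suc b * 1) ⟩
  suc b * 1 * suc a                     ≤⟨ m≤m+n _ _ ⟩
  suc b * 1 * suc a + suc b * 1 * suc a ∎))
  where
  open ≤-Reasoning
  simplify : ∀ a w → a * 1 * 1 + 0 * w * w ≡ a
  simplify = ℕ.solve-∀
quadratic⇒det a b       c@(suc _) q = *-cancelˡ-≤ c (+-cancelʳ-≤ (c * (b * b)) _ _
  (subst₂ _≤_ (cong₂ _+_ (shape₁ b c) (shape₁ b c)) (cong₂ _+_ (shape₂ a c) (*-assoc c b b)) (q c b)))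
  where
  shape₁ : ∀ b c → b * c * b ≡ c * (b * b)
  shape₁ = ℕ.solve-∀
  shape₂ : ∀ a c → a * c * c ≡ c * (a * c)
  shape₂ = ℕ.solve-∀

psd⇒det : (A : Mat 2 2) → DoublyNonnegative A →
  A zero (suc zero) * A zero (suc zero) ≤ A zero zero * A (suc zero) (suc zero)
psd⇒det A (symmetric , psd) =
  quadratic⇒det (A zero zero) (A zero (suc zero)) (A (suc zero) (suc zero)) (psd⇒quadratic A symmetric psd)

∑-lookup : ∀ {n} (u v : Vec ℕ n) → ∑ n (λ l → lookup u l * lookup v l) ≡ dot u v
∑-lookup []       []       = refl
∑-lookup (x ∷ xs) (y ∷ ys) = cong (x * y +_) (∑-lookup xs ys)

theorem7 : (A : Mat 2 2) → DoublyNonnegative A →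
    Σ (Mat 2 10) (λ B → ∀ i j → (B ·ᵀ) i j ≡ A i j)
theorem7 A A-dnn@(symmetric , _) = B , B·Bᵀ≡A
  where
  a = A zero zero
  b = A zero (suc zero)
  c = A (suc zero) (suc zero)
  open Gram (det⇒gram a b c (psd⇒det A A-dnn))
  B : Mat 2 10
  B zero    = lookup x
  B (suc _) = lookup y
  B·Bᵀ≡A : ∀ i j → (B ·ᵀ) i j ≡ A i j
  B·Bᵀ≡A zero       zero       = trans (∑-lookup x x) x·x
  B·Bᵀ≡A zero       (suc zero) = trans (∑-lookup x y) x·y
  B·Bᵀ≡A (suc zero) zero       = trans (∑-lookup y x) (trans (dot-comm y x) (trans x·y (symmetric zero (suc zero))))
  B·Bᵀ≡A (suc zero) (suc zero) = trans (∑-lookup y y) y·y
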